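{- Consider a locally-greedy asynchronous collective tree exploration algorithm with targets, and a single robot starting at the root that performs $m$ moves at some instants within $\{1,\dots,M\}$, each prescribed by rule R1 or rule R2. Let $(v_t)_{t\in[M]}$ be the sequence of consecutive targets of this robot, with $v_1=\texttt{root}$. Then the robot uses rule R1 at least $$\frac{1}{2}\left(m-\sum_{t<M}d(v_t,v_{t+1})\right)$$ times, where $d$ denotes the distance in the tree.
   Context: Asynchronous collective tree exploration (ACTE): $k$ robots start at the root of an unknown tree; at each step $t$ an arbitrary (adversarially chosen) robot $r_t\in\{1,\dots,k\}$ is the only one allowed to move, along one adjacent edge; at the beginning of move $t$ the centrally controlled team is only additionally told whether $r_t$ is adjacent to an unexplored edge, and if so can move along it. A locally-greedy ACTE algorithm with targets maintains at all times, for each robot $r$, an already explored node $v_t(r)$ called its target (initially the root), and the $t$-th move is determined by: R1. if robot $r_t$ is adjacent to an unexplored edge, it moves along that edge; R2. otherwise it moves along the adjacent edge leading towards its target $v_t(r_t)$; R3. robot $r_t$ does not stay at its location (so the target is changed beforehand if $r_t$ is at its target and not adjacent to an unexplored edge). -}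

module Defs where

open import Data.Nat using (ℕ; zero; suc; _+_; _∸_)
open import Data.Nat.Properties using (_≟_)
open import Data.List using (List; []; _∷_; length; _++_; [_])
open import Data.Product using (Σ; ∃; _×_)
open import Relation.Nullary using (¬_; yes; no)
open import Relation.Binary.PropositionalEquality using (_≡_)

-- Rooted trees, Ulam–Harris style.
-- A node is its address: the list of child-indices read from the root.

Node : Set
Node = List ℕ

root : Node
root = []

record RootedTree : Set₁ where
  field
    InT        : Node → Set
    root∈      : InT root
    parent∈    : ∀ u c → InT (u ++ [ c ]) → InT u
open RootedTree public

Adj : Node → Node → Set
Adj u w = (Σ ℕ λ c → w ≡ u ++ [ c ]) Data.Sum.⊎ (Σ ℕ λ c → u ≡ w ++ [ c ])
  where import Data.Sum

-- length of the longest common prefix (= depth of the lowest common ancestor)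
lcp : Node → Node → ℕ
lcp [] _ = zero
lcp (_ ∷ _) [] = zero
lcp (x ∷ xs) (y ∷ ys) with x ≟ y
... | yes _ = suc (lcp xs ys)
... | no _  = zero

-- tree distance: d(u,v) = depth u + depth v − 2 depth(lca u v)
dist : Node → Node → ℕ
dist u v = (length u ∸ lcp u v) + (length v ∸ lcp u v)

data Action : Set where
  idle : Action   -- robot is not the one allowed to move at t
  useR1 : Action
  useR2 : Action

isMove : Action → ℕ
isMove idle  = 0
isMove useR1 = 1
isMove useR2 = 1

isR1 : Action → ℕ
isR1 useR1 = 1
isR1 _     = 0

sumFrom1 : (ℕ → ℕ) → ℕ → ℕ
sumFrom1 f zero    = zero
sumFrom1 f (suc n) = sumFrom1 f n + f (suc n)

-- A valid behaviour of one robot of a locally-greedy ACTE algorithm with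
-- targets, during instants 1..M.
--   pos t   : position after instant t (pos 0 = root),
--   tgt t   : target v_t in force during move t (after a possible R3 change),
--   act t   : whether the robot moves at t and by which rule,
--   Unexp t u w : the edge {u,w} is unexplored at the beginning of move t.

StepOK : RootedTree → (ℕ → Node → Node → Set) →
         (ℕ → Node) → (ℕ → Node) → (ℕ → Action) → ℕ → Set
StepOK T Unexp pos tgt act t with act t
... | idle  = pos t ≡ pos (t ∸ 1)
... | useR1 = Adj (pos (t ∸ 1)) (pos t) × InT T (pos t)
              × Unexp t (pos (t ∸ 1)) (pos t)
... | useR2 = (∀ w → Adj (pos (t ∸ 1)) w → InT T w → ¬ Unexp t (pos (t ∸ 1)) w)
              × Adj (pos (t ∸ 1)) (pos t) × InT T (pos t)
              × suc (dist (pos t) (tgt t)) ≡ dist (pos (t ∸ 1)) (tgt t)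

-- Amortisation with the potential  #R2-moves + d(position, target).  An R1
-- move raises the distance to the current target by at most one, an R2 move
-- lowers it by exactly one, an idle instant leaves it unchanged, and replacing
-- the target v_t by v_{t+1} raises it by at most d(v_t, v_{t+1}) (triangle
-- inequality).  Since the potential starts at 0 and is nonnegative,
-- #R2 ≤ #R1 + Σ d(v_t, v_{t+1}), and the number of moves is #R1 + #R2.
module Submission where

open import Defs
open import Data.Nat using (ℕ; zero; suc; _+_; _*_; _∸_; _≤_; z≤n; s≤s)
open import Data.Nat.Properties
open import Data.Nat.Tactic.RingSolver using (solve-∀)
open import Data.List using ([]; _∷_; length; _++_; [_])
open import Data.Product using (_,_; proj₁; proj₂)
open import Data.Sum using (inj₁; inj₂)
open import Relation.Nullary using (yes; no; contradiction)
open import Relation.Binary.PropositionalEquality hiding ([_])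

open ≤-Reasoning

lcp-comm : ∀ u v → lcp u v ≡ lcp v u
lcp-comm []       []       = refl
lcp-comm []       (_ ∷ _)  = refl
lcp-comm (_ ∷ _)  []       = refl
lcp-comm (x ∷ xs) (y ∷ ys) with x ≟ y | y ≟ x
... | yes _    | yes _    = cong suc (lcp-comm xs ys)
... | yes refl | no x≢x   = contradiction refl x≢x
... | no x≢x   | yes refl = contradiction refl x≢x
... | no _     | no _     = refl

dist-sym : ∀ u v → dist u v ≡ dist v u
dist-sym u v rewrite lcp-comm u v = +-comm (length u ∸ lcp v u) (length v ∸ lcp v u)

dist-self : ∀ u → dist u u ≡ 0
dist-self []       = refl
dist-self (x ∷ xs) with x ≟ x
... | yes _  = dist-self xs
... | no x≢x = contradiction refl x≢x

dist-≤-length+length : ∀ u v → dist u v ≤ length u + length v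
dist-≤-length+length []       v        = ≤-refl
dist-≤-length+length (x ∷ xs) []       = ≤-refl
dist-≤-length+length (x ∷ xs) (y ∷ ys) with x ≟ y
... | yes _ = begin
  dist xs ys                    ≤⟨ dist-≤-length+length xs ys ⟩
  length xs + length ys         ≤⟨ +-monoʳ-≤ (length xs) (n≤1+n (length ys)) ⟩
  length xs + suc (length ys)   ≤⟨ n≤1+n _ ⟩
  suc (length xs + suc (length ys)) ∎
... | no _  = ≤-refl

length-≤-dist+length : ∀ u v → length u ≤ dist u v + length v
length-≤-dist+length []       v        = z≤n
length-≤-dist+length (x ∷ xs) []       = ≤-trans (m≤m+n _ 0) (m≤m+n _ 0)
length-≤-dist+length (x ∷ xs) (y ∷ ys) with x ≟ y
... | yes _ = begin
  suc (length xs)                ≤⟨ s≤s (length-≤-dist+length xs ys) ⟩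
  suc (dist xs ys + length ys)   ≡⟨ +-suc (dist xs ys) (length ys) ⟨
  dist xs ys + suc (length ys)   ∎
... | no _  = ≤-trans (m≤m+n _ (suc (length ys))) (m≤m+n _ (suc (length ys)))

length-≤-length+dist : ∀ u v → length v ≤ length u + dist u v
length-≤-length+dist u v = begin
  length v                ≤⟨ length-≤-dist+length v u ⟩
  dist v u + length u     ≡⟨ cong (_+ length u) (dist-sym v u) ⟩
  dist u v + length u     ≡⟨ +-comm (dist u v) (length u) ⟩
  length u + dist u v     ∎

-- Whenever v branches off u or w at the root, the bound d ≤ |u| + |w| suffices.
dist-triangle : ∀ u v w → dist u w ≤ dist u v + dist v w
dist-triangle []           v  w  = length-≤-length+dist v w
dist-triangle u@(_ ∷ _)    [] w  = begin
  dist u w                     ≤⟨ dist-≤-length+length u w ⟩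
  length u + length w          ≡⟨ cong (_+ length w) (+-identityʳ (length u)) ⟨
  length u + 0 + length w      ∎
dist-triangle u@(_ ∷ _) v@(_ ∷ _) [] = begin
  length u + 0                 ≡⟨ +-identityʳ (length u) ⟩
  length u                     ≤⟨ length-≤-dist+length u v ⟩
  dist u v + length v          ≡⟨ cong (dist u v +_) (+-identityʳ (length v)) ⟨
  dist u v + (length v + 0)    ∎
dist-triangle u@(x ∷ xs) v@(y ∷ ys) w@(z ∷ zs) with x ≟ y
... | no _ = begin
  dist u w                     ≤⟨ dist-≤-length+length u w ⟩
  length u + length w          ≤⟨ +-monoʳ-≤ (length u) (length-≤-length+dist v w) ⟩
  length u + (length v + dist v w) ≡⟨ +-assoc (length u) (length v) (dist v w) ⟨
  length u + length v + dist v w ∎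
... | yes x≡y with y ≟ z
...   | no _ = begin
  dist u w                     ≤⟨ dist-≤-length+length u w ⟩
  length u + length w          ≤⟨ +-monoˡ-≤ (length w) (s≤s (length-≤-dist+length xs ys)) ⟩
  suc (dist xs ys + length ys) + length w ≡⟨ cong (_+ length w) (+-suc (dist xs ys) (length ys)) ⟨
  dist xs ys + length v + length w   ≡⟨ +-assoc (dist xs ys) (length v) (length w) ⟩
  dist xs ys + (length v + length w) ∎
...   | yes y≡z with x ≟ z
...     | yes _  = dist-triangle xs ys zs
...     | no x≢z = contradiction (trans x≡y y≡z) x≢z

dist-child : ∀ u c → dist u (u ++ [ c ]) ≡ 1
dist-child []       c = refl
dist-child (x ∷ xs) c with x ≟ x
... | yes _  = dist-child xs c
... | no x≢x = contradiction refl x≢x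

dist-adjacent : ∀ {u w} → Adj u w → dist u w ≡ 1
dist-adjacent {u} (inj₁ (c , refl)) = dist-child u c
dist-adjacent {w = w} (inj₂ (c , refl)) = trans (dist-sym (w ++ [ c ]) w) (dist-child w c)

dist-adjacent-≤ : ∀ {u w} x → Adj u w → dist w x ≤ suc (dist u x)
dist-adjacent-≤ {u} {w} x adj = begin
  dist w x             ≤⟨ dist-triangle w u x ⟩
  dist w u + dist u x  ≡⟨ cong (_+ dist u x) (trans (dist-sym w u) (dist-adjacent adj)) ⟩
  suc (dist u x)       ∎

+-+-comm : ∀ a b c d → (a + b) + (c + d) ≡ (a + c) + (b + d)
+-+-comm = solve-∀

sumFrom1-cong : ∀ {f g} → (∀ t → f t ≡ g t) → ∀ n → sumFrom1 f n ≡ sumFrom1 g n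
sumFrom1-cong f≗g zero    = refl
sumFrom1-cong f≗g (suc n) = cong₂ _+_ (sumFrom1-cong f≗g n) (f≗g (suc n))

sumFrom1-+ : ∀ f g n → sumFrom1 (λ t → f t + g t) n ≡ sumFrom1 f n + sumFrom1 g n
sumFrom1-+ f g zero    = refl
sumFrom1-+ f g (suc n) = begin-equality
  sumFrom1 (λ t → f t + g t) n + (f (suc n) + g (suc n))
    ≡⟨ cong (_+ (f (suc n) + g (suc n))) (sumFrom1-+ f g n) ⟩
  (sumFrom1 f n + sumFrom1 g n) + (f (suc n) + g (suc n))
    ≡⟨ +-+-comm (sumFrom1 f n) (sumFrom1 g n) (f (suc n)) (g (suc n)) ⟩
  (sumFrom1 f n + f (suc n)) + (sumFrom1 g n + g (suc n)) ∎

isR2 : Action → ℕ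
isR2 useR2 = 1
isR2 _     = 0

isMove≡isR1+isR2 : ∀ a → isMove a ≡ isR1 a + isR2 a
isMove≡isR1+isR2 idle  = refl
isMove≡isR1+isR2 useR1 = refl
isMove≡isR1+isR2 useR2 = refl

moves≡R1+R2 : ∀ (act : ℕ → Action) n →
  sumFrom1 (λ t → isMove (act t)) n
    ≡ sumFrom1 (λ t → isR1 (act t)) n + sumFrom1 (λ t → isR2 (act t)) n
moves≡R1+R2 act n = trans (sumFrom1-cong (λ t → isMove≡isR1+isR2 (act t)) n)
                          (sumFrom1-+ (λ t → isR1 (act t)) (λ t → isR2 (act t)) n)

stepOK-potential : ∀ T Unexp pos tgt act t → StepOK T Unexp pos tgt act t →
  isR2 (act t) + dist (pos t) (tgt t) ≤ isR1 (act t) + dist (pos (t ∸ 1)) (tgt t)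
stepOK-potential T Unexp pos tgt act t ok with act t
... | idle  = ≤-reflexive (cong (λ p → dist p (tgt t)) ok)
... | useR1 = dist-adjacent-≤ (tgt t) (proj₁ ok)
... | useR2 = ≤-reflexive (proj₂ (proj₂ (proj₂ ok)))

potential-bound : ∀ (pos tgt : ℕ → Node) (gain loss : ℕ → ℕ) → pos 0 ≡ tgt 1 → ∀ k →
  (∀ t → 1 ≤ t → t ≤ suc k →
     loss t + dist (pos t) (tgt t) ≤ gain t + dist (pos (t ∸ 1)) (tgt t)) →
  sumFrom1 loss (suc k) + dist (pos (suc k)) (tgt (suc k))
    ≤ sumFrom1 gain (suc k) + sumFrom1 (λ t → dist (tgt t) (tgt (suc t))) k
potential-bound pos tgt gain loss p0 zero steps =
  subst (λ d → loss 1 + dist (pos 1) (tgt 1) ≤ gain 1 + d)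
        (trans (cong (λ p → dist p (tgt 1)) p0) (dist-self (tgt 1)))
        (steps 1 ≤-refl ≤-refl)
potential-bound pos tgt gain loss p0 (suc k) steps = begin
  (L + loss t) + dist (pos t) (tgt t)       ≡⟨ +-assoc L (loss t) _ ⟩
  L + (loss t + dist (pos t) (tgt t))       ≤⟨ +-monoʳ-≤ L (steps t (s≤s z≤n) ≤-refl) ⟩
  L + (gain t + dist (pos (suc k)) (tgt t)) ≤⟨ +-monoʳ-≤ L (+-monoʳ-≤ (gain t) retarget) ⟩
  L + (gain t + (D + e))                    ≡⟨ regroup L (gain t) D e ⟩
  (L + D) + (gain t + e)                    ≤⟨ +-monoˡ-≤ (gain t + e) IH ⟩
  (G + S) + (gain t + e)                    ≡⟨ +-+-comm G S (gain t) e ⟩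
  (G + gain t) + (S + e)                    ∎
  where
  t = suc (suc k)
  L = sumFrom1 loss (suc k)
  G = sumFrom1 gain (suc k)
  S = sumFrom1 (λ s → dist (tgt s) (tgt (suc s))) k
  D = dist (pos (suc k)) (tgt (suc k))
  e = dist (tgt (suc k)) (tgt t)
  IH : L + D ≤ G + S
  IH = potential-bound pos tgt gain loss p0 k (λ s 1≤s s≤ → steps s 1≤s (m≤n⇒m≤1+n s≤))
  retarget : dist (pos (suc k)) (tgt t) ≤ D + e
  retarget = dist-triangle (pos (suc k)) (tgt (suc k)) (tgt t)
  regroup : ∀ a b c d → a + (b + (c + d)) ≡ (a + c) + (b + d)
  regroup = solve-∀

-- Neither the tree membership of the targets nor the tree itself matters:
-- dist is a metric on all addresses.
lemma3p9 : (T : RootedTree) (Unexp : ℕ → Node → Node → Set)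
    (M : ℕ) (pos tgt : ℕ → Node) (act : ℕ → Action) →
    pos 0 ≡ root →
    tgt 1 ≡ root →
    (∀ t → 1 ≤ t → t ≤ M → InT T (tgt t)) →
    (∀ t → 1 ≤ t → t ≤ M → StepOK T Unexp pos tgt act t) →
    sumFrom1 (λ t → isMove (act t)) M
      ≤ 2 * sumFrom1 (λ t → isR1 (act t)) M
        + sumFrom1 (λ t → dist (tgt t) (tgt (suc t))) (M ∸ 1)
lemma3p9 T Unexp zero    pos tgt act p0 t1 _ ok = z≤n
lemma3p9 T Unexp (suc k) pos tgt act p0 t1 _ ok = begin
  sumFrom1 (λ t → isMove (act t)) (suc k) ≡⟨ moves≡R1+R2 act (suc k) ⟩
  R1 + R2                                 ≤⟨ +-monoʳ-≤ R1 R2≤R1+S ⟩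
  R1 + (R1 + S)                           ≡⟨ double R1 S ⟩
  2 * R1 + S                              ∎
  where
  R1 = sumFrom1 (λ t → isR1 (act t)) (suc k)
  R2 = sumFrom1 (λ t → isR2 (act t)) (suc k)
  S  = sumFrom1 (λ t → dist (tgt t) (tgt (suc t))) k
  R2≤R1+S : R2 ≤ R1 + S
  R2≤R1+S = ≤-trans (m≤m+n R2 _)
    (potential-bound pos tgt (λ t → isR1 (act t)) (λ t → isR2 (act t)) (trans p0 (sym t1)) k
      (λ t 1≤t t≤ → stepOK-potential T Unexp pos tgt act t (ok t 1≤t t≤)))
  double : ∀ a s → a + (a + s) ≡ 2 * a + s
  double = solve-∀
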